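{- For all integers $n,k$ with $2\leq k\leq n$, there is a binary relation $\mathbf{C}=(C_-,C_+,C)$ such that $\delta(\mathbf{C})=n$ and $\delta(\mathbf{C}^\perp)=k$.
   Context: A binary relation is a triple $\mathbf{A}=(A_-,A_+,A)$ where $A_-,A_+$ are sets and $A\subseteq A_-\times A_+$. A subset $Y\subseteq A_+$ is $\mathbf{A}$-dominating if for every $a\in A_-$ there is $\alpha\in Y$ with $a\mathrel{A}\alpha$. The dominating number $\delta(\mathbf{A})$ is the minimum cardinality of an $\mathbf{A}$-dominating family, and $\delta(\mathbf{A})=\infty$ if no dominating family exists. The dual of $\mathbf{A}$ is $\mathbf{A}^\perp=(A_+,A_-,R)$ where for $x\in A_+$, $y\in A_-$, $x\mathrel{R}y$ holds if and only if $y\mathrel{A}x$ fails. -}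

module Defs where

open import Data.Nat using (ℕ; _≤_)
open import Data.Fin using (Fin)
open import Data.Bool using (Bool; true)
open import Data.Product using (Σ; ∃; _×_)
open import Relation.Nullary using (¬_)
open import Relation.Binary.PropositionalEquality using (_≡_)
open import Function.Bundles using (_↔_)

record BinRel : Set₁ where
  field
    Neg : Set
    Pos : Set
    Rel : Neg → Pos → Set
open BinRel public

Subset : Set → Set
Subset X = X → Bool

_∈_ : {X : Set} → X → Subset X → Set
x ∈ Y = Y x ≡ true

HasCard : {X : Set} → Subset X → ℕ → Set
HasCard {X} Y m = Fin m ↔ Σ X (λ x → x ∈ Y)

Dominating : (A : BinRel) → Subset (Pos A) → Set
Dominating A Y = ∀ (a : Neg A) → ∃ λ α → α ∈ Y × Rel A a α

-- δ(A) = n (n finite): some dominating family has cardinality n, and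
-- every finite dominating family has cardinality ≥ n (infinite families
-- automatically have cardinality > n).
DomNumberIs : BinRel → ℕ → Set
DomNumberIs A n =
  (Σ (Subset (Pos A)) λ Y → Dominating A Y × HasCard Y n)
  × (∀ (Y : Subset (Pos A)) (m : ℕ) → Dominating A Y → HasCard Y m → n ≤ m)

dual : BinRel → BinRel
dual A = record { Neg = Pos A ; Pos = Neg A ; Rel = λ x y → ¬ Rel A y x }

-- Take n·K points (K = k - 1), arranged as n rows of length K, and let each
-- positive element list K points: either one whole row, or an arbitrary
-- K-tuple. A positive lists only K points, so n·K points need n positives,
-- and the n rows suffice. Dually, a family Z of points dominates C^⊥ iff no
-- positive lists all of Z; at most K points can always be listed by a
-- K-tuple, while K + 1 distinct points never fit into a list of length K.
module Submission where

open import Defs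
open import Data.Nat using (ℕ; _≤_)
open import Data.Product using (Σ; _×_)

open import Axiom.UniquenessOfIdentityProofs using (module Decidable⇒UIP)
open import Data.Bool using (true; false)
open import Data.Bool.Properties using (T-≡) renaming (_≟_ to _≟ᵇ_)
open import Data.Empty using (⊥-elim)
open import Data.Fin using (Fin; zero; toℕ; fromℕ<; inject≤)
open import Data.Fin.Properties
  using (any?; all?; ¬∀⟶∃¬; injective⇒≤; *↔×; toℕ<n; toℕ-inject≤; fromℕ<-cong; fromℕ<-toℕ; inject≤-injective)
  renaming (_≟_ to _≟ᶠ_)
open import Data.Nat using (NonZero; _<_; _<?_; suc; s≤s)
open import Data.Nat.Properties using (*-cancelʳ-≤; ≤-pred; ≰⇒>; n≮n)
open import Data.Product using (_,_; proj₁; proj₂; ∃)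
open import Data.Product.Properties using (≡-dec)
open import Data.Sum using (_⊎_; inj₁; inj₂)
open import Function using (_∘_)
open import Function.Bundles using (_↣_; Inverse; Injection; Equivalence; mk↔ₛ′; mk↣)
open import Function.Definitions using (Injective)
open import Function.Properties.Inverse using (↔⇒↣; ↔-sym)
open import Function.Construct.Composition using (_↣-∘_)
open import Relation.Binary.Definitions using (DecidableEquality)
open import Relation.Binary.PropositionalEquality using (_≡_; refl; sym; trans; cong; subst; module ≡-Reasoning)
open import Relation.Nullary using (yes; no)
open import Relation.Nullary.Decidable using (isYes; toWitness; fromWitness)

↣⇒≤ : {m n : ℕ} → Fin m ↣ Fin n → m ≤ n
↣⇒≤ f = injective⇒≤ (Injection.injective f)

pad : {A : Set} {m K : ℕ} → m ≤ K → A → (Fin m → A) → Fin K → A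
pad {m = m} m≤K a f j with toℕ j <? m
... | yes j<m = f (fromℕ< j<m)
... | no _    = a

pad-inject≤ : {A : Set} {m K : ℕ} (m≤K : m ≤ K) (a : A) (f : Fin m → A) (t : Fin m) →
              pad m≤K a f (inject≤ t m≤K) ≡ f t
pad-inject≤ {m = m} m≤K a f t with toℕ (inject≤ t m≤K) <? m
... | yes j<m = cong f (trans (fromℕ<-cong _ _ (toℕ-inject≤ t m≤K) j<m (toℕ<n t)) (fromℕ<-toℕ t (toℕ<n t)))
... | no j≮m  = ⊥-elim (j≮m (subst (_< m) (sym (toℕ-inject≤ t m≤K)) (toℕ<n t)))

module _ {X : Set} (_≟_ : DecidableEquality X) {k : ℕ} (g : Fin k → X) where

  image : Subset X
  image x = isYes (any? λ t → g t ≟ x)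

  ∈-image : (t : Fin k) → g t ∈ image
  ∈-image t = Equivalence.to T-≡ (fromWitness (t , refl))

  ∈-image⁻ : {x : X} → x ∈ image → ∃ λ t → g t ≡ x
  ∈-image⁻ x∈ = toWitness (Equivalence.from T-≡ x∈)

  image-card : Injective _≡_ _≡_ g → HasCard image k
  image-card g-inj = mk↔ₛ′ to from to∘from from∘to
    where
    to : Fin k → Σ X (_∈ image)
    to t = g t , ∈-image t
    from : Σ X (_∈ image) → Fin k
    from (_ , x∈) = proj₁ (∈-image⁻ x∈)
    to∘from : ∀ y → to (from y) ≡ y
    to∘from (x , x∈) with ∈-image⁻ x∈
    ... | t , refl = cong (g t ,_) (Decidable⇒UIP.≡-irrelevant _≟ᵇ_ _ _)
    from∘to : ∀ t → from (to t) ≡ t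
    from∘to t = g-inj (proj₂ (∈-image⁻ (∈-image t)))

listRel : {N P : Set} {K : ℕ} → (P → Fin K → N) → BinRel
listRel {N} {P} entries = record { Neg = N ; Pos = P ; Rel = λ a p → ∃ λ j → entries p j ≡ a }

module _ {N P : Set} {K : ℕ} (entries : P → Fin K → N) where

  dominating↣ : {Y : Subset P} {m : ℕ} → Dominating (listRel entries) Y → HasCard Y m →
                N ↣ (Fin m × Fin K)
  dominating↣ {m = m} dom e = mk↣ {to = position} position-injective
    where
    position : N → Fin m × Fin K
    position a with dom a
    ... | α , α∈ , j , _ = Inverse.from e (α , α∈) , j
    entry : Fin m × Fin K → N
    entry (t , j) = entries (proj₁ (Inverse.to e t)) j
    entry∘position : ∀ a → entry (position a) ≡ a
    entry∘position a with dom a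
    ... | α , α∈ , j , eq rewrite Inverse.strictlyInverseˡ e (α , α∈) = eq
    position-injective : Injective _≡_ _≡_ position
    position-injective {a} {b} eq = begin
      a                   ≡⟨ sym (entry∘position a) ⟩
      entry (position a)  ≡⟨ cong entry eq ⟩
      entry (position b)  ≡⟨ entry∘position b ⟩
      b                   ∎
      where open ≡-Reasoning

  distinct-dual-dominating : (_≟_ : DecidableEquality N) (g : Fin (suc K) → N) →
                             Injective _≡_ _≡_ g → Dominating (dual (listRel entries)) (image _≟_ g)
  distinct-dual-dominating _≟_ g g-inj p with all? (λ t → any? (λ j → entries p j ≟ g t))
  ... | yes all-listed = ⊥-elim (n≮n K (injective⇒≤ slot-injective))
    where
    slot : Fin (suc K) → Fin K
    slot t = proj₁ (all-listed t)
    slot-injective : Injective _≡_ _≡_ slot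
    slot-injective {s} {t} eq =
      g-inj (trans (sym (proj₂ (all-listed s))) (trans (cong (entries p) eq) (proj₂ (all-listed t))))
  ... | no ¬all-listed with ¬∀⟶∃¬ (suc K) _ (λ t → any? (λ j → entries p j ≟ g t)) ¬all-listed
  ... | t , unlisted = g t , ∈-image _≟_ g t , unlisted

  dual-dominating⇒> : (∀ {m} → m ≤ K → (f : Fin m → N) → ∃ λ p → ∀ t → ∃ λ j → entries p j ≡ f t) →
                      {Z : Subset N} {m : ℕ} → Dominating (dual (listRel entries)) Z → HasCard Z m → K < m
  dual-dominating⇒> listable {m = m} dom e with K <? m
  ... | yes K<m = K<m
  ... | no K≮m with listable (≤-pred (≰⇒> K≮m)) (proj₁ ∘ Inverse.to e)
  ... | p , lists with dom p
  ... | z , z∈ , unlisted = ⊥-elim (unlisted (subst (λ y → ∃ λ j → entries p j ≡ y) z-entry (lists t)))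
    where
    t = Inverse.from e (z , z∈)
    z-entry : proj₁ (Inverse.to e t) ≡ z
    z-entry = cong proj₁ (Inverse.strictlyInverseˡ e (z , z∈))

module Construction (n K : ℕ) where

  Point : Set
  Point = Fin n × Fin K

  Block : Set
  Block = Fin n ⊎ (Fin K → Point)

  entries : Block → Fin K → Point
  entries (inj₁ i) j = i , j
  entries (inj₂ f) = f

  C : BinRel
  C = listRel entries

  rows : Subset Block
  rows (inj₁ _) = true
  rows (inj₂ _) = false

  rows-card : HasCard rows n
  rows-card = mk↔ₛ′ (λ i → inj₁ i , refl) from (λ { (inj₁ i , refl) → refl ; (inj₂ _ , ()) }) (λ _ → refl)
    where
    from : Σ Block (_∈ rows) → Fin n
    from (inj₁ i , _) = i
    from (inj₂ _ , ())

  rows-dominating : Dominating C rows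
  rows-dominating (i , j) = inj₁ i , refl , j , refl

  δ[C] : .{{_ : NonZero K}} → DomNumberIs C n
  δ[C] = (rows , rows-dominating , rows-card) , λ Y m dom e →
    *-cancelʳ-≤ n m K (↣⇒≤ (↔⇒↣ (↔-sym *↔×) ↣-∘ (dominating↣ entries dom e ↣-∘ ↔⇒↣ *↔×)))

  δ[C⊥] : Fin K → suc K ≤ n → DomNumberIs (dual C) (suc K)
  δ[C⊥] j₀ k≤n = (image _≟_ diagonal , distinct-dual-dominating entries _≟_ diagonal diagonal-injective
                                      , image-card _≟_ diagonal diagonal-injective)
               , λ Z m dom e → dual-dominating⇒> entries listable dom e
    where
    _≟_ : DecidableEquality Point
    _≟_ = ≡-dec _≟ᶠ_ _≟ᶠ_
    diagonal : Fin (suc K) → Point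
    diagonal t = inject≤ t k≤n , j₀
    diagonal-injective : Injective _≡_ _≡_ diagonal
    diagonal-injective eq = inject≤-injective k≤n k≤n _ _ (cong proj₁ eq)
    listable : ∀ {m} → m ≤ K → (f : Fin m → Point) → ∃ λ p → ∀ t → ∃ λ j → entries p j ≡ f t
    listable m≤K f = inj₂ (pad m≤K (diagonal zero) f) , λ t → inject≤ t m≤K , pad-inject≤ m≤K _ f t

lemma6p4 : (n k : ℕ) → 2 ≤ k → k ≤ n →
    Σ BinRel λ C → DomNumberIs C n × DomNumberIs (dual C) k
lemma6p4 n (suc (suc K)) (s≤s (s≤s _)) k≤n = C , δ[C] , δ[C⊥] zero k≤n
  where open Construction n (suc K)
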